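{- For every positive integer $s$, the set $\{(0,1),(1,1)\}$ is an $s$-spanning set in $\mathbb{Z}_s\times\mathbb{Z}_{2s}$; that is, every element of $\mathbb{Z}_s\times\mathbb{Z}_{2s}$ equals $\lambda_1(0,1)+\lambda_2(1,1)$ for some integers $\lambda_1,\lambda_2$ with $|\lambda_1|+|\lambda_2|\le s$.
   Context: $\mathbb{Z}_n=\mathbb{Z}/n\mathbb{Z}$. A subset $A$ of an abelian group $G$ is an $s$-spanning set if every element of $G$ is a signed sum of at most $s$ (not necessarily distinct) elements of $A$. -}

module Defs where

open import Data.Nat using (ℕ)
open import Data.Integer using (ℤ; +_; _-_)
open import Data.Integer.Divisibility using (_∣_)

_≡_[mod_] : ℤ → ℤ → ℕ → Set
x ≡ y [mod n ] = (+ n) ∣ (x - y)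

-- Let p and q be the representatives of b − a and b − a + s modulo 2s of least
-- absolute value; then |p| + |q| = s.  Both λ₂ = a, λ₁ = p and λ₂ = a − s, λ₁ = q
-- solve the congruences, at costs |p| + a and |q| + (s − a).  These costs add up
-- to 2s, so one of them is at most s.
module Submission where

open import Defs
open import Data.Nat using (ℕ; NonZero; _*_; _≤_; _<_; _∸_; _≤?_)
open import Data.Fin using (Fin; toℕ)
open import Data.Integer using (ℤ; +_; _+_; _-_; ∣_∣)
open import Data.Integer.DivMod using (_%ℕ_; _/ℕ_; n%ℕd<d; a≡a%ℕn+[a/ℕn]*n)
open import Data.Integer.Divisibility using (_∣_)
open import Data.Integer.Divisibility.Signed using (∣ᵤ⇒∣; ∣⇒∣ᵤ; ∣m∣n⇒∣m+n; divides)
open import Data.Integer.Tactic.RingSolver using (solve-∀)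
open import Data.Product using (Σ; _×_; _,_)
open import Data.Sum using (_⊎_; inj₁; inj₂)
open import Relation.Nullary using (yes; no)
open import Relation.Binary.PropositionalEquality using (_≡_; sym; trans; cong; subst; module ≡-Reasoning)
import Data.Nat as N
import Data.Integer as Z
import Data.Nat.Divisibility as ND
import Data.Nat.Properties as NP
import Data.Integer.Properties as IP
import Data.Fin.Properties as FP

2*n≡n+n : ∀ n → 2 * n ≡ n N.+ n
2*n≡n+n n = cong (n N.+_) (NP.+-identityʳ n)

m-n≡+[m∸n] : ∀ {m n} → n ≤ m → + m - + n ≡ + (m ∸ n)
m-n≡+[m∸n] {m} {n} n≤m = trans (IP.m-n≡m⊖n m n) (IP.⊖-≥ n≤m)

∣m-n∣≡n∸m : ∀ {m n} → m ≤ n → ∣ + m - + n ∣ ≡ n ∸ m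
∣m-n∣≡n∸m {m} {n} m≤n = trans (IP.∣i-j∣≡∣j-i∣ (+ m) (+ n)) (cong ∣_∣ (m-n≡+[m∸n] m≤n))

-- x ≡ y [mod n ] unfolds to a statement about x - y, from which Agda cannot
-- recover x and y; hence the explicit arguments of the congruence lemmas.
≡-mod-by-difference : ∀ x y x′ y′ {n} → x - y ≡ x′ - y′ → x ≡ y [mod n ] → x′ ≡ y′ [mod n ]
≡-mod-by-difference _ _ _ _ {n} eq = subst (+ n ∣_) eq

≡-mod-refl : ∀ x {n} → x ≡ x [mod n ]
≡-mod-refl x {n} = subst (+ n ∣_) (sym (IP.+-inverseʳ x)) (n ND.∣0)

≡-mod-trans : ∀ x y z {n} → x ≡ y [mod n ] → y ≡ z [mod n ] → x ≡ z [mod n ]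
≡-mod-trans x y z {n} x≡y y≡z =
  subst (+ n ∣_) (telescope x y z)
    (∣⇒∣ᵤ (∣m∣n⇒∣m+n (∣ᵤ⇒∣ {k = + n} {i = x - y} x≡y) (∣ᵤ⇒∣ {k = + n} {i = y - z} y≡z)))
  where
  telescope : ∀ x y z → (x - y) + (y - z) ≡ x - z
  telescope = solve-∀

≡-mod-+ʳ : ∀ x y z {n} → x ≡ y [mod n ] → (x + z) ≡ (y + z) [mod n ]
≡-mod-+ʳ x y z = ≡-mod-by-difference x y (x + z) (y + z) (cancel x y z)
  where
  cancel : ∀ x y z → x - y ≡ (x + z) - (y + z)
  cancel = solve-∀

≡-mod-modulus : ∀ x y {n} → x - y ≡ + n → x ≡ y [mod n ]
≡-mod-modulus _ _ {n} eq = subst (+ n ∣_) (sym eq) ND.∣-refl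

≡-mod-residue : ∀ x n .{{_ : NonZero n}} → x ≡ (+ (x %ℕ n)) [mod n ]
≡-mod-residue x n = ∣⇒∣ᵤ (divides (x /ℕ n) (begin
  x - + (x %ℕ n)                               ≡⟨ cong (_- + (x %ℕ n)) (a≡a%ℕn+[a/ℕn]*n x n) ⟩
  (+ (x %ℕ n) + (x /ℕ n) Z.* + n) - + (x %ℕ n) ≡⟨ cancel (+ (x %ℕ n)) ((x /ℕ n) Z.* + n) ⟩
  (x /ℕ n) Z.* + n                             ∎))
  where
  open ≡-Reasoning
  cancel : ∀ r m → (r + m) - r ≡ m
  cancel = solve-∀

pos-2*n : ∀ n → + (2 * n) ≡ + n + + n
pos-2*n n = trans (cong +_ (2*n≡n+n n)) (IP.pos-+ n n)

x+n≡x-n[mod2n] : ∀ x n → (x + + n) ≡ (x - + n) [mod (2 * n) ]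
x+n≡x-n[mod2n] x n = ≡-mod-modulus (x + + n) (x - + n) (trans (shift x (+ n)) (sym (pos-2*n n)))
  where
  shift : ∀ x m → (x + m) - (x - m) ≡ m + m
  shift = solve-∀

x≡x-n-n[mod2n] : ∀ x n → x ≡ ((x - + n) - + n) [mod (2 * n) ]
x≡x-n-n[mod2n] x n = ≡-mod-modulus x ((x - + n) - + n) (trans (shift x (+ n)) (sym (pos-2*n n)))
  where
  shift : ∀ x m → x - ((x - m) - m) ≡ m + m
  shift = solve-∀

complementaryResidues : ∀ n r → r < 2 * n →
  Σ ℤ λ p → Σ ℤ λ q → ∣ p ∣ N.+ ∣ q ∣ ≡ n × ((+ r) ≡ p [mod (2 * n) ]) × ((+ r + + n) ≡ q [mod (2 * n) ])
complementaryResidues n r r<2n with r ≤? n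
... | yes r≤n =
  + r , + r - + n ,
  trans (cong (r N.+_) (∣m-n∣≡n∸m r≤n)) (NP.m+[n∸m]≡n r≤n) ,
  ≡-mod-refl (+ r) ,
  x+n≡x-n[mod2n] (+ r) n
... | no r≰n =
  (+ r - + n) - + n , + r - + n ,
  abs-sum ,
  x≡x-n-n[mod2n] (+ r) n ,
  x+n≡x-n[mod2n] (+ r) n
  where
  open ≡-Reasoning
  n≤r : n ≤ r
  n≤r = NP.<⇒≤ (NP.≰⇒> r≰n)
  r∸n≤n : r ∸ n ≤ n
  r∸n≤n = NP.m≤n+o⇒m∸n≤o r n (NP.<⇒≤ (subst (r <_) (2*n≡n+n n) r<2n))
  abs-sum : ∣ (+ r - + n) - + n ∣ N.+ ∣ + r - + n ∣ ≡ n
  abs-sum = begin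
    ∣ (+ r - + n) - + n ∣ N.+ ∣ + r - + n ∣ ≡⟨ cong (λ i → ∣ i - + n ∣ N.+ ∣ i ∣) (m-n≡+[m∸n] n≤r) ⟩
    ∣ + (r ∸ n) - + n ∣ N.+ (r ∸ n)         ≡⟨ cong (N._+ (r ∸ n)) (∣m-n∣≡n∸m r∸n≤n) ⟩
    (n ∸ (r ∸ n)) N.+ (r ∸ n)               ≡⟨ NP.m∸n+n≡m r∸n≤n ⟩
    n                                       ∎

complementaryRepresentatives : ∀ n .{{_ : NonZero n}} (x : ℤ) →
  Σ ℤ λ p → Σ ℤ λ q → ∣ p ∣ N.+ ∣ q ∣ ≡ n × (x ≡ p [mod (2 * n) ]) × ((x + + n) ≡ q [mod (2 * n) ])
complementaryRepresentatives n x =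
  let p , q , sum , r≡p , r+n≡q = complementaryResidues n r (n%ℕd<d x (2 * n))
  in  p , q , sum , ≡-mod-trans x (+ r) p x≡r r≡p ,
      ≡-mod-trans (x + + n) (+ r + + n) q (≡-mod-+ʳ x (+ r) (+ n) x≡r) r+n≡q
  where
  instance
    2n≢0 : NonZero (2 * n)
    2n≢0 = NP.m*n≢0 2 n
  r : ℕ
  r = x %ℕ (2 * n)
  x≡r : x ≡ (+ r) [mod (2 * n) ]
  x≡r = ≡-mod-residue x (2 * n)

m+n≡o⇒m+k≤o⊎n+[o∸k]≤o : ∀ {m n o} k → m N.+ n ≡ o → m N.+ k ≤ o ⊎ n N.+ (o ∸ k) ≤ o
m+n≡o⇒m+k≤o⊎n+[o∸k]≤o {m} {n} {o} k m+n≡o with m N.+ k ≤? o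
... | yes m+k≤o = inj₁ m+k≤o
... | no  m+k≰o = inj₂ (begin
  n N.+ (o ∸ k) ≤⟨ NP.+-monoʳ-≤ n o∸k≤m ⟩
  n N.+ m       ≡⟨ NP.+-comm n m ⟩
  m N.+ n       ≡⟨ m+n≡o ⟩
  o             ∎)
  where
  open NP.≤-Reasoning
  o∸k≤m : o ∸ k ≤ m
  o∸k≤m = NP.m≤n+o⇒m∸n≤o o k (subst (o ≤_) (NP.+-comm m k) (NP.<⇒≤ (NP.≰⇒> m+k≰o)))

signedSum-spanning : ∀ s .{{_ : NonZero s}} a (b : ℤ) → a ≤ s →
  Σ ℤ λ l₁ → Σ ℤ λ l₂ → ∣ l₁ ∣ N.+ ∣ l₂ ∣ ≤ s × ((+ a) ≡ l₂ [mod s ]) × (b ≡ (l₁ + l₂) [mod (2 * s) ])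
signedSum-spanning s a b a≤s with complementaryRepresentatives s (b - + a)
... | p , q , sum , b-a≡p , b-a+s≡q with m+n≡o⇒m+k≤o⊎n+[o∸k]≤o a sum
...   | inj₁ cost≤s =
  p , + a , cost≤s , ≡-mod-refl (+ a) ,
  ≡-mod-by-difference (b - + a) p b (p + + a) (regroup₁ b (+ a) p) b-a≡p
  where
  regroup₁ : ∀ b a p → (b - a) - p ≡ b - (p + a)
  regroup₁ = solve-∀
...   | inj₂ cost≤s =
  q , + a - + s , subst (λ c → ∣ q ∣ N.+ c ≤ s) (sym (∣m-n∣≡n∸m a≤s)) cost≤s ,
  ≡-mod-modulus (+ a) (+ a - + s) (drop (+ a) (+ s)) ,
  ≡-mod-by-difference ((b - + a) + + s) q b (q + (+ a - + s)) (regroup₂ b (+ a) (+ s) q) b-a+s≡q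
  where
  drop : ∀ a s → a - (a - s) ≡ s
  drop = solve-∀
  regroup₂ : ∀ b a s q → ((b - a) + s) - q ≡ b - (q + (a - s))
  regroup₂ = solve-∀

mainTheorem5 : (s : ℕ) → .{{_ : NonZero s}} → (a : Fin s) → (b : Fin (2 * s)) → Σ ℤ (λ l₁ → Σ ℤ (λ l₂ → (∣ l₁ ∣ N.+ ∣ l₂ ∣ N.≤ s) × ((+ toℕ a) ≡ l₂ [mod s ]) × ((+ toℕ b) ≡ (l₁ + l₂) [mod (2 * s) ])))
mainTheorem5 s a b = signedSum-spanning s (toℕ a) (+ toℕ b) (NP.<⇒≤ (FP.toℕ<n a))
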